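{- Let $G=G^{(0)}$ be a signed graph on $n>1$ nodes with canonical marking, having $n_+$ positively marked and $n_-$ negatively marked nodes, and let $G^{(m)}$, $m\ge1$, be the signed corona graph generated by $G$. For a node $v$ of $G^{(0)}$, let $d_0^+(v),d_0^-(v)$ be its positive and negative degree in $G^{(0)}$ and $\mu(v)$ its canonical marking in $G^{(0)}$. Then its positive degree $d^+(v)$ and negative degree $d^-(v)$ in $G^{(m)}$ are: (1) if $n_+,n_-$ are both odd: for $m$ even (either marking), $d^+(v)=d_0^+(v)+\frac m2(n_++n_-)$, $d^-(v)=d_0^-(v)+\frac m2(n_++n_-)$; for $m$ odd and $\mu(v)=+$, $d^+(v)=d_0^+(v)+\frac{m+1}{2}n_++\frac{m-1}{2}n_-$, $d^-(v)=d_0^-(v)+\frac{m+1}{2}n_-+\frac{m-1}{2}n_+$; for $m$ odd and $\mu(v)=-$, $d^+(v)=d_0^+(v)+\frac{m+1}{2}n_-+\frac{m-1}{2}n_+$, $d^-(v)=d_0^-(v)+\frac{m+1}{2}n_++\frac{m-1}{2}n_-$; (2) if $n_+$ is even and $n_-$ odd: if $\mu(v)=+$, $d^+(v)=d_0^+(v)+n_++(m-1)n_-$, $d^-(v)=d_0^-(v)+n_-+(m-1)n_+$; if $\mu(v)=-$, $d^+(v)=d_0^+(v)+mn_-$, $d^-(v)=d_0^-(v)+mn_+$; (3) if $n_+,n_-$ are both even: if $\mu(v)=+$, $d^+(v)=d_0^+(v)+mn_+$, $d^-(v)=d_0^-(v)+mn_-$; if $\mu(v)=-$, $d^+(v)=d_0^+(v)+mn_-$,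 $d^-(v)=d_0^-(v)+mn_+$; (4) if $n_+$ is odd and $n_-$ even: if $\mu(v)=+$, $d^+(v)=d_0^+(v)+mn_+$, $d^-(v)=d_0^-(v)+mn_-$; if $\mu(v)=-$, $d^+(v)=d_0^+(v)+n_-+(m-1)n_+$, $d^-(v)=d_0^-(v)+n_++(m-1)n_-$.
   Context: A signed graph has edges signed $+$ or $-$; $d^\pm(v)$ are the numbers of positive/negative edges at $v$. The canonical marking of a node $v$ is $\mu(v)=\prod_{e\ni v}\sigma(e)$, the product of the signs of all edges incident to $v$ (so $\mu(v)=+$ iff $d^-(v)$ is even). Corona product of signed graphs $H_1$ (nodes $u_1,\dots,u_N$) and $H_2$, each canonically marked: take one copy of $H_1$ and $N$ copies of $H_2$ and join $u_i$ to every node of the $i$-th copy of $H_2$, the edge from $u_i$ to the copy of $w$ having sign $\mu_{H_1}(u_i)\mu_{H_2}(w)$. Signed corona graphs generated by the seed graph $G$: $G^{(0)}=G$ and $G^{(m)}=G^{(m-1)}\circ G$ for $m\ge1$, where at each step $G^{(m-1)}$ carries its own canonical marking (as a signed graph) and $G$ its canonical marking. The nodes of $G^{(0)}$ are regarded as nodes of every $G^{(m)}$. -}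

module Defs where

open import Data.Nat using (ℕ; zero; suc; _+_; _*_)
open import Data.Fin using (Fin; zero; suc; splitAt; remQuot; _↑ˡ_; _≟_)
open import Data.Maybe using (Maybe; just; nothing)
open import Data.Sum using (_⊎_; inj₁; inj₂)
open import Data.Product using (_×_; _,_)
open import Data.Bool using (Bool; true; false; if_then_else_)
open import Relation.Nullary.Decidable using (⌊_⌋)

data Sign : Set where
  plus minus : Sign

_·_ : Sign → Sign → Sign
plus  · s     = s
minus · plus  = minus
minus · minus = plus

_==ˢ_ : Sign → Sign → Bool
plus  ==ˢ plus  = true
minus ==ˢ minus = true
_     ==ˢ _     = false

-- A signed graph on nodes Fin n: adj u v = nothing (no edge) or just σ (edge of sign σ).
Adj : ℕ → Set
Adj n = Fin n → Fin n → Maybe Sign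

countFin : ∀ {n} → (Fin n → Bool) → ℕ
countFin {zero}  p = 0
countFin {suc n} p = (if p zero then 1 else 0) + countFin (λ i → p (suc i))

prodFin : ∀ {n} → (Fin n → Sign) → Sign
prodFin {zero}  f = plus
prodFin {suc n} f = f zero · prodFin (λ i → f (suc i))

hasSign : Sign → Maybe Sign → Bool
hasSign s nothing  = false
hasSign s (just t) = s ==ˢ t

posDeg : ∀ {n} → Adj n → Fin n → ℕ
posDeg A v = countFin (λ u → hasSign plus (A v u))

negDeg : ∀ {n} → Adj n → Fin n → ℕ
negDeg A v = countFin (λ u → hasSign minus (A v u))

edgeSign : Maybe Sign → Sign
edgeSign nothing  = plus
edgeSign (just s) = s

marking : ∀ {n} → Adj n → Fin n → Sign
marking A v = prodFin (λ u → edgeSign (A v u))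

nPos : ∀ {n} → Adj n → ℕ
nPos A = countFin (λ v → marking A v ==ˢ plus)

nNeg : ∀ {n} → Adj n → ℕ
nNeg A = countFin (λ v → marking A v ==ˢ minus)

-- Corona product H₁ ∘ H₂ (canonical markings), nodes Fin (N + N * k):
-- first N nodes = H₁, node (i , w) of the block N * k = copy of w in the i-th copy of H₂.
part : ∀ N k → Fin (N + N * k) → Fin N ⊎ (Fin N × Fin k)
part N k x with splitAt N x
... | inj₁ i = inj₁ i
... | inj₂ y = inj₂ (remQuot k y)

coronaSum : ∀ {N k} → Adj N → Adj k →
            Fin N ⊎ (Fin N × Fin k) → Fin N ⊎ (Fin N × Fin k) → Maybe Sign
coronaSum A B (inj₁ i) (inj₁ j) = A i j
coronaSum A B (inj₁ i) (inj₂ (j , w)) =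
  if ⌊ i ≟ j ⌋ then just (marking A i · marking B w) else nothing
coronaSum A B (inj₂ (i , w)) (inj₁ j) =
  if ⌊ i ≟ j ⌋ then just (marking A j · marking B w) else nothing
coronaSum A B (inj₂ (i , w)) (inj₂ (j , w')) =
  if ⌊ i ≟ j ⌋ then B w w' else nothing

corona : ∀ {N k} → Adj N → Adj k → Adj (N + N * k)
corona {N} {k} A B x y = coronaSum A B (part N k x) (part N k y)

size : ℕ → ℕ → ℕ
size n zero    = n
size n (suc m) = size n m + size n m * n

coronaPow : ∀ {n} → Adj n → (m : ℕ) → Adj (size n m)
coronaPow G zero    = G
coronaPow G (suc m) = corona (coronaPow G m) G

embed : ∀ {n} (m : ℕ) → Fin n → Fin (size n m)
embed zero    v = v
embed {n} (suc m) v = embed m v ↑ˡ (size n m * n)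

module Submission where

-- A node u of G⁽ᵐ⁾ (an original node of G included) is joined in G⁽ᵐ⁺¹⁾ to
-- the n nodes of its own copy of G, the edge to the copy of w having sign
-- μₘ(u)·μ(w).  Hence the s-signed degree grows by the number of nodes of G
-- with marking μₘ(u)·s (`corona-degree`).  Since a marking is the parity of
-- the negative degree (`marking-parity`), the marking evolves by the rule
-- μₘ₊₁ = μₘ · (−1)^(number of nodes marked −μₘ), and the parities of n₊, n₋
-- decide its behaviour: it alternates (both odd), settles at − (n₊ even, n₋
-- odd), stays fixed (both even) or settles at + (n₊ odd, n₋ even).

open import Defs
open import Data.Nat using (ℕ; zero; suc; _+_; _*_; _∸_; _/_; _%_; _≤_; _<_; s≤s; z≤n)
open import Data.Nat.Properties using (+-assoc; +-comm; +-identityʳ)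
open import Data.Nat.DivMod using (m/n≡1+[m∸n]/n)
open import Data.Nat.Tactic.RingSolver using (solve-∀)
open import Data.Fin using (Fin; zero; suc; _↑ˡ_; _↑ʳ_; remQuot; _≟_)
open import Data.Fin.Properties using (splitAt-↑ˡ; splitAt-↑ʳ; remQuot-combine)
open import Data.Maybe using (Maybe; just; nothing)
open import Data.Product using (_×_; _,_; proj₁; proj₂; map₁)
open import Data.Sum using (inj₁; inj₂)
open import Data.Bool using (Bool; true; false; if_then_else_)
open import Relation.Nullary.Decidable using (⌊_⌋; isYes≗does; dec-true; dec-false)
open import Relation.Binary.PropositionalEquality
  using (_≡_; _≢_; refl; sym; trans; cong; cong₂; module ≡-Reasoning)

open ≡-Reasoning

·-assoc : ∀ a b c → (a · b) · c ≡ a · (b · c)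
·-assoc plus  b     c     = refl
·-assoc minus plus  c     = refl
·-assoc minus minus plus  = refl
·-assoc minus minus minus = refl

·minus-involutive : ∀ a → (a · minus) · minus ≡ a
·minus-involutive plus  = refl
·minus-involutive minus = refl

signPow : ℕ → Sign
signPow zero    = plus
signPow (suc k) = minus · signPow k

signPow-+ : ∀ a b → signPow (a + b) ≡ signPow a · signPow b
signPow-+ zero    b = refl
signPow-+ (suc a) b =
  trans (cong (minus ·_) (signPow-+ a b)) (sym (·-assoc minus (signPow a) (signPow b)))

signPow-even : ∀ k → k % 2 ≡ 0 → signPow k ≡ plus
signPow-even zero          _ = refl
signPow-even (suc zero)    ()
signPow-even (suc (suc k)) h =
  trans (sym (·-assoc minus minus (signPow k))) (signPow-even k h)

signPow-odd : ∀ k → k % 2 ≡ 1 → signPow k ≡ minus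
signPow-odd zero          ()
signPow-odd (suc zero)    _ = refl
signPow-odd (suc (suc k)) h =
  trans (sym (·-assoc minus minus (signPow k))) (signPow-odd k h)

prodFin-signPow : ∀ {n} (f : Fin n → Sign) →
  prodFin f ≡ signPow (countFin (λ i → f i ==ˢ minus))
prodFin-signPow {zero}  f = refl
prodFin-signPow {suc n} f with f zero
... | plus  = prodFin-signPow (λ i → f (suc i))
... | minus = cong (minus ·_) (prodFin-signPow (λ i → f (suc i)))

countFin-cong : ∀ {n} {p q : Fin n → Bool} → (∀ i → p i ≡ q i) → countFin p ≡ countFin q
countFin-cong {zero}  h = refl
countFin-cong {suc n} h =
  cong₂ (λ b c → (if b then 1 else 0) + c) (h zero) (countFin-cong (λ i → h (suc i)))

countFin-none : ∀ {n} (p : Fin n → Bool) → (∀ i → p i ≡ false) → countFin p ≡ 0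
countFin-none {zero}  p h = refl
countFin-none {suc n} p h
  rewrite h zero = countFin-none (λ i → p (suc i)) (λ i → h (suc i))

countFin-split : ∀ a b (p : Fin (a + b) → Bool) →
  countFin p ≡ countFin (λ i → p (i ↑ˡ b)) + countFin (λ j → p (a ↑ʳ j))
countFin-split zero    b p = refl
countFin-split (suc a) b p =
  trans (cong ((if p zero then 1 else 0) +_) (countFin-split a b (λ i → p (suc i))))
        (sym (+-assoc (if p zero then 1 else 0) _ _))

remQuot-↑ʳ : ∀ N k (y : Fin (N * k)) → remQuot {suc N} k (k ↑ʳ y) ≡ map₁ suc (remQuot {N} k y)
remQuot-↑ʳ N k y rewrite splitAt-↑ʳ k (N * k) y = refl

countFin-block : ∀ N k (p : Fin N × Fin k → Bool) (i : Fin N) →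
  (∀ j w → j ≢ i → p (j , w) ≡ false) →
  countFin {N * k} (λ y → p (remQuot k y)) ≡ countFin (λ w → p (i , w))
countFin-block (suc N) k p i outside = begin
  countFin (λ y → p (remQuot k y))
    ≡⟨ countFin-split k (N * k) (λ y → p (remQuot k y)) ⟩
  countFin (λ w → p (remQuot k (w ↑ˡ (N * k)))) + countFin (λ y → p (remQuot k (k ↑ʳ y)))
    ≡⟨ cong₂ _+_ (countFin-cong (λ w → cong p (remQuot-combine {suc N} zero w)))
                 (countFin-cong (λ y → cong p (remQuot-↑ʳ N k y))) ⟩
  countFin (λ w → p (zero , w)) + countFin (λ y → p (map₁ suc (remQuot k y)))
    ≡⟨ pick i outside ⟩
  countFin (λ w → p (i , w)) ∎
  where
  block : Fin (N * k) → Fin N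
  block y = proj₁ (remQuot {N} k y)

  offset : Fin (N * k) → Fin k
  offset y = proj₂ (remQuot {N} k y)

  -- Either block 0 is the chosen one and the other blocks vanish, or block 0
  -- vanishes and the remaining N blocks are handled by induction.
  pick : ∀ i → (∀ j w → j ≢ i → p (j , w) ≡ false) →
    countFin (λ w → p (zero , w)) + countFin (λ y → p (map₁ suc (remQuot {N} k y)))
      ≡ countFin (λ w → p (i , w))
  pick zero outside =
    trans (cong (countFin (λ w → p (zero , w)) +_)
                (countFin-none _ (λ y → outside (suc (block y)) (offset y) λ ())))
          (+-identityʳ _)
  pick (suc i) outside =
    trans (cong (_+ countFin (λ y → p (map₁ suc (remQuot {N} k y))))
                (countFin-none _ (λ w → outside zero w λ ())))
          (countFin-block N k (λ jw → p (map₁ suc jw)) i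
             (λ j w j≢i → outside (suc j) w (λ { refl → j≢i refl })))

edgeSign-minus : ∀ x → (edgeSign x ==ˢ minus) ≡ hasSign minus x
edgeSign-minus nothing      = refl
edgeSign-minus (just plus)  = refl
edgeSign-minus (just minus) = refl

marking-parity : ∀ {n} (A : Adj n) (v : Fin n) → marking A v ≡ signPow (negDeg A v)
marking-parity A v =
  trans (prodFin-signPow (λ u → edgeSign (A v u)))
        (cong signPow (countFin-cong (λ u → edgeSign-minus (A v u))))

-- The corona edge u_i — (copy of w) has sign s iff μ(w) = μ(u_i)·s.
hasSign-· : ∀ μ s t → hasSign s (just (μ · t)) ≡ (t ==ˢ (μ · s))
hasSign-· plus  plus  plus  = refl
hasSign-· plus  plus  minus = refl
hasSign-· plus  minus plus  = refl
hasSign-· plus  minus minus = refl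
hasSign-· minus plus  plus  = refl
hasSign-· minus plus  minus = refl
hasSign-· minus minus plus  = refl
hasSign-· minus minus minus = refl

≟-self : ∀ {N} (i : Fin N) → ⌊ i ≟ i ⌋ ≡ true
≟-self i = trans (isYes≗does (i ≟ i)) (dec-true (i ≟ i) refl)

≟-distinct : ∀ {N} (i j : Fin N) → j ≢ i → ⌊ i ≟ j ⌋ ≡ false
≟-distinct i j j≢i = trans (isYes≗does (i ≟ j)) (dec-false (i ≟ j) (λ i≡j → j≢i (sym i≡j)))

part-↑ˡ : ∀ N k (i : Fin N) → part N k (i ↑ˡ (N * k)) ≡ inj₁ i
part-↑ˡ N k i rewrite splitAt-↑ˡ N i (N * k) = refl

part-↑ʳ : ∀ N k (y : Fin (N * k)) → part N k (N ↑ʳ y) ≡ inj₂ (remQuot k y)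
part-↑ʳ N k y rewrite splitAt-↑ʳ N (N * k) y = refl

corona-degree : ∀ {N k} (A : Adj N) (B : Adj k) (i : Fin N) (s : Sign) →
  countFin (λ y → hasSign s (corona A B (i ↑ˡ (N * k)) y))
    ≡ countFin (λ j → hasSign s (A i j)) + countFin (λ w → marking B w ==ˢ (marking A i · s))
corona-degree {N} {k} A B i s = begin
  countFin (λ y → hasSign s (row y))
    ≡⟨ countFin-split N (N * k) (λ y → hasSign s (row y)) ⟩
  countFin (λ j → hasSign s (row (j ↑ˡ (N * k)))) + countFin (λ y → hasSign s (row (N ↑ʳ y)))
    ≡⟨ cong₂ _+_ (countFin-cong (λ j → cong (hasSign s) (to-H₁ j)))
                 (countFin-cong (λ y → cong (hasSign s) (to-copies y))) ⟩
  countFin (λ j → hasSign s (A i j)) + countFin (λ y → joinSign (remQuot k y))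
    ≡⟨ cong (countFin (λ j → hasSign s (A i j)) +_)
            (countFin-block N k joinSign i (λ j w j≢i → cong (link w) (≟-distinct i j j≢i))) ⟩
  countFin (λ j → hasSign s (A i j)) + countFin (λ w → joinSign (i , w))
    ≡⟨ cong (countFin (λ j → hasSign s (A i j)) +_)
            (countFin-cong (λ w → trans (cong (link w) (≟-self i))
                                        (hasSign-· (marking A i) s (marking B w)))) ⟩
  countFin (λ j → hasSign s (A i j)) + countFin (λ w → marking B w ==ˢ (marking A i · s)) ∎
  where
  row : Fin (N + N * k) → Maybe Sign
  row = corona A B (i ↑ˡ (N * k))

  link : Fin k → Bool → Bool
  link w b = hasSign s (if b then just (marking A i · marking B w) else nothing)

  joinSign : Fin N × Fin k → Bool
  joinSign (j , w) = hasSign s (coronaSum A B (inj₁ i) (inj₂ (j , w)))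

  to-H₁ : ∀ j → row (j ↑ˡ (N * k)) ≡ A i j
  to-H₁ j = cong₂ (coronaSum A B) (part-↑ˡ N k i) (part-↑ˡ N k j)

  to-copies : ∀ y → row (N ↑ʳ y) ≡ coronaSum A B (inj₁ i) (inj₂ (remQuot k y))
  to-copies y = cong₂ (coronaSum A B) (part-↑ˡ N k i) (part-↑ʳ N k y)

half-suc-suc : ∀ m → suc (suc m) / 2 ≡ suc (m / 2)
half-suc-suc m = m/n≡1+[m∸n]/n {suc (suc m)} {2} (s≤s (s≤s z≤n))

half-even : ∀ m → m % 2 ≡ 0 → suc m / 2 ≡ m / 2
half-even zero          _ = refl
half-even (suc zero)    ()
half-even (suc (suc m)) h = begin
  suc (suc (suc m)) / 2 ≡⟨ half-suc-suc (suc m) ⟩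
  suc (suc m / 2)       ≡⟨ cong suc (half-even m h) ⟩
  suc (m / 2)           ≡⟨ sym (half-suc-suc m) ⟩
  suc (suc m) / 2       ∎

half-odd : ∀ m → m % 2 ≡ 1 → m / 2 ≡ (m ∸ 1) / 2
half-odd zero                ()
half-odd (suc zero)          _ = refl
half-odd (suc (suc zero))    ()
half-odd (suc (suc (suc m))) h = begin
  suc (suc (suc m)) / 2 ≡⟨ half-suc-suc (suc m) ⟩
  suc (suc m / 2)       ≡⟨ cong suc (half-odd (suc m) h) ⟩
  suc (m / 2)           ≡⟨ sym (half-suc-suc m) ⟩
  suc (suc m) / 2       ∎

module Accumulation (M : ℕ → Sign) (inc : Sign → ℕ) (D : ℕ → ℕ)
                    (D-step : ∀ m → D (suc m) ≡ D m + inc (M m)) where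

  accumulate-settled : ∀ σ → (∀ k → M (suc k) ≡ σ) →
    ∀ k → D (suc k) ≡ D 0 + inc (M 0) + k * inc σ
  accumulate-settled σ settled zero    = trans (D-step 0) (sym (+-identityʳ _))
  accumulate-settled σ settled (suc k) = begin
    D (suc (suc k))                           ≡⟨ D-step (suc k) ⟩
    D (suc k) + inc (M (suc k))               ≡⟨ cong₂ _+_ (accumulate-settled σ settled k)
                                                           (cong inc (settled k)) ⟩
    D 0 + inc (M 0) + k * inc σ + inc σ       ≡⟨ ar (D 0 + inc (M 0)) (inc σ) k ⟩
    D 0 + inc (M 0) + suc k * inc σ           ∎
    where
    ar : ∀ a c k → a + k * c + c ≡ a + suc k * c
    ar = solve-∀

  module _ (alternates : ∀ k → M (suc k) ≡ M k · minus) where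

    pair-invariant : ∀ m → inc (M m) + inc (M m · minus) ≡ inc (M 0) + inc (M 0 · minus)
    pair-invariant zero    = refl
    pair-invariant (suc m) = begin
      inc (M (suc m)) + inc (M (suc m) · minus)
        ≡⟨ cong (λ t → inc t + inc (t · minus)) (alternates m) ⟩
      inc (M m · minus) + inc ((M m · minus) · minus)
        ≡⟨ cong (λ t → inc (M m · minus) + inc t) (·minus-involutive (M m)) ⟩
      inc (M m · minus) + inc (M m)
        ≡⟨ +-comm (inc (M m · minus)) (inc (M m)) ⟩
      inc (M m) + inc (M m · minus)
        ≡⟨ pair-invariant m ⟩
      inc (M 0) + inc (M 0 · minus) ∎

    accumulate-alternating : ∀ m →
      D m ≡ D 0 + (suc m / 2) * inc (M 0) + (m / 2) * inc (M 0 · minus)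
    accumulate-alternating zero          = sym (trans (+-identityʳ _) (+-identityʳ _))
    accumulate-alternating (suc zero)    = trans (D-step 0) (ar₁ (D 0) (inc (M 0)))
      where
      ar₁ : ∀ d a → d + a ≡ d + 1 * a + 0 * a
      ar₁ = solve-∀
    accumulate-alternating (suc (suc m)) = begin
      D (suc (suc m))
        ≡⟨ D-step (suc m) ⟩
      D (suc m) + inc (M (suc m))
        ≡⟨ cong₂ _+_ (D-step m) (cong inc (alternates m)) ⟩
      D m + inc (M m) + inc (M m · minus)
        ≡⟨ +-assoc (D m) _ _ ⟩
      D m + (inc (M m) + inc (M m · minus))
        ≡⟨ cong₂ _+_ (accumulate-alternating m) (pair-invariant m) ⟩
      D 0 + (suc m / 2) * a + (m / 2) * b + (a + b)
        ≡⟨ ar₂ (D 0) (suc m / 2) (m / 2) a b ⟩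
      D 0 + suc (suc m / 2) * a + suc (m / 2) * b
        ≡⟨ sym (cong₂ (λ x y → D 0 + x * a + y * b) (half-suc-suc (suc m)) (half-suc-suc m)) ⟩
      D 0 + (suc (suc (suc m)) / 2) * a + (suc (suc m) / 2) * b ∎
      where
      a = inc (M 0)
      b = inc (M 0 · minus)
      ar₂ : ∀ d x y a b → d + x * a + y * b + (a + b) ≡ d + suc x * a + suc y * b
      ar₂ = solve-∀

module Iteration {n} (G : Adj n) (v : Fin n) where

  μ : ℕ → Sign
  μ m = marking (coronaPow G m) (embed m v)

  deg : Sign → ℕ → ℕ
  deg s m = countFin (λ u → hasSign s (coronaPow G m (embed m v) u))

  count : Sign → ℕ
  count σ = countFin (λ w → marking G w ==ˢ σ)

  deg-step : ∀ s m → deg s (suc m) ≡ deg s m + count (μ m · s)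
  deg-step s m = corona-degree (coronaPow G m) G (embed m v) s

  next : Sign → Sign
  next t = t · signPow (count (t · minus))

  μ-step : ∀ m → μ (suc m) ≡ next (μ m)
  μ-step m = begin
    μ (suc m)
      ≡⟨ marking-parity (coronaPow G (suc m)) (embed (suc m) v) ⟩
    signPow (deg minus (suc m))
      ≡⟨ cong signPow (deg-step minus m) ⟩
    signPow (deg minus m + count (μ m · minus))
      ≡⟨ signPow-+ (deg minus m) _ ⟩
    signPow (deg minus m) · signPow (count (μ m · minus))
      ≡⟨ cong (_· signPow (count (μ m · minus))) (sym (marking-parity (coronaPow G m) (embed m v))) ⟩
    next (μ m) ∎

  next-odd-odd : count plus % 2 ≡ 1 → count minus % 2 ≡ 1 → ∀ t → next t ≡ t · minus
  next-odd-odd hp hq plus  = signPow-odd (count minus) hq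
  next-odd-odd hp hq minus = cong (minus ·_) (signPow-odd (count plus) hp)

  next-even-odd : count plus % 2 ≡ 0 → count minus % 2 ≡ 1 → ∀ t → next t ≡ minus
  next-even-odd hp hq plus  = signPow-odd (count minus) hq
  next-even-odd hp hq minus = cong (minus ·_) (signPow-even (count plus) hp)

  next-even-even : count plus % 2 ≡ 0 → count minus % 2 ≡ 0 → ∀ t → next t ≡ t
  next-even-even hp hq plus  = signPow-even (count minus) hq
  next-even-even hp hq minus = cong (minus ·_) (signPow-even (count plus) hp)

  next-odd-even : count plus % 2 ≡ 1 → count minus % 2 ≡ 0 → ∀ t → next t ≡ plus
  next-odd-even hp hq plus  = signPow-even (count minus) hq
  next-odd-even hp hq minus = cong (minus ·_) (signPow-odd (count plus) hp)

  deg-settled : ∀ σ → (∀ k → μ (suc k) ≡ σ) → ∀ t → μ 0 ≡ t →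
    ∀ s k → deg s (suc k) ≡ deg s 0 + count (t · s) + k * count (σ · s)
  deg-settled σ settled .(μ 0) refl s =
    Accumulation.accumulate-settled μ (λ t → count (t · s)) (deg s) (deg-step s) σ settled

  deg-alternating : (∀ k → μ (suc k) ≡ μ k · minus) → ∀ t → μ 0 ≡ t →
    ∀ s m → deg s m ≡ deg s 0 + (suc m / 2) * count (t · s) + (m / 2) * count ((t · minus) · s)
  deg-alternating alternates .(μ 0) refl s =
    Accumulation.accumulate-alternating μ (λ t → count (t · s)) (deg s) (deg-step s) alternates

  count-pair : ∀ t s → count (t · s) + count ((t · minus) · s) ≡ count plus + count minus
  count-pair plus  plus  = refl
  count-pair plus  minus = +-comm (count minus) (count plus)
  count-pair minus plus  = +-comm (count minus) (count plus)
  count-pair minus minus = refl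

  deg-alternating-even : (∀ k → μ (suc k) ≡ μ k · minus) → ∀ m → m % 2 ≡ 0 →
    ∀ s → deg s m ≡ deg s 0 + (m / 2) * (count plus + count minus)
  deg-alternating-even alternates m even s = begin
    deg s m
      ≡⟨ deg-alternating alternates (μ 0) refl s m ⟩
    deg s 0 + (suc m / 2) * count (μ 0 · s) + (m / 2) * count ((μ 0 · minus) · s)
      ≡⟨ cong (λ x → deg s 0 + x * count (μ 0 · s) + (m / 2) * count ((μ 0 · minus) · s))
              (half-even m even) ⟩
    deg s 0 + (m / 2) * count (μ 0 · s) + (m / 2) * count ((μ 0 · minus) · s)
      ≡⟨ factor (deg s 0) (m / 2) (count (μ 0 · s)) (count ((μ 0 · minus) · s)) ⟩
    deg s 0 + (m / 2) * (count (μ 0 · s) + count ((μ 0 · minus) · s))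
      ≡⟨ cong (λ x → deg s 0 + (m / 2) * x) (count-pair (μ 0) s) ⟩
    deg s 0 + (m / 2) * (count plus + count minus) ∎
    where
    factor : ∀ d h x y → d + h * x + h * y ≡ d + h * (x + y)
    factor = solve-∀

  deg-alternating-odd : (∀ k → μ (suc k) ≡ μ k · minus) → ∀ m → m % 2 ≡ 1 →
    ∀ t → μ 0 ≡ t → ∀ s →
    deg s m ≡ deg s 0 + (suc m / 2) * count (t · s) + ((m ∸ 1) / 2) * count ((t · minus) · s)
  deg-alternating-odd alternates m odd t μ₀ s =
    trans (deg-alternating alternates t μ₀ s m)
          (cong (λ x → deg s 0 + (suc m / 2) * count (t · s) + x * count ((t · minus) · s))
                (half-odd m odd))

  case-odd-odd : ∀ m → count plus % 2 ≡ 1 → count minus % 2 ≡ 1 →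
       (m % 2 ≡ 0 →
          deg plus m ≡ deg plus 0 + (m / 2) * (count plus + count minus)
        × deg minus m ≡ deg minus 0 + (m / 2) * (count plus + count minus))
     × (m % 2 ≡ 1 → μ 0 ≡ plus →
          deg plus m ≡ deg plus 0 + (suc m / 2) * count plus + ((m ∸ 1) / 2) * count minus
        × deg minus m ≡ deg minus 0 + (suc m / 2) * count minus + ((m ∸ 1) / 2) * count plus)
     × (m % 2 ≡ 1 → μ 0 ≡ minus →
          deg plus m ≡ deg plus 0 + (suc m / 2) * count minus + ((m ∸ 1) / 2) * count plus
        × deg minus m ≡ deg minus 0 + (suc m / 2) * count plus + ((m ∸ 1) / 2) * count minus)
  case-odd-odd m hp hq =
      (λ even → deg-alternating-even alternates m even plus
              , deg-alternating-even alternates m even minus)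
    , (λ odd μ₀ → deg-alternating-odd alternates m odd plus μ₀ plus
                , deg-alternating-odd alternates m odd plus μ₀ minus)
    , (λ odd μ₀ → deg-alternating-odd alternates m odd minus μ₀ plus
                , deg-alternating-odd alternates m odd minus μ₀ minus)
    where
    alternates : ∀ k → μ (suc k) ≡ μ k · minus
    alternates k = trans (μ-step k) (next-odd-odd hp hq (μ k))

  case-even-odd : ∀ k → count plus % 2 ≡ 0 → count minus % 2 ≡ 1 →
       (μ 0 ≡ plus →
          deg plus (suc k) ≡ deg plus 0 + count plus + k * count minus
        × deg minus (suc k) ≡ deg minus 0 + count minus + k * count plus)
     × (μ 0 ≡ minus →
          deg plus (suc k) ≡ deg plus 0 + suc k * count minus
        × deg minus (suc k) ≡ deg minus 0 + suc k * count plus)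
  case-even-odd k hp hq =
      (λ μ₀ → deg-settled minus settled plus μ₀ plus k
            , deg-settled minus settled plus μ₀ minus k)
    , (λ μ₀ → trans (deg-settled minus settled minus μ₀ plus k) (+-assoc (deg plus 0) _ _)
            , trans (deg-settled minus settled minus μ₀ minus k) (+-assoc (deg minus 0) _ _))
    where
    settled : ∀ j → μ (suc j) ≡ minus
    settled j = trans (μ-step j) (next-even-odd hp hq (μ j))

  case-even-even : ∀ k → count plus % 2 ≡ 0 → count minus % 2 ≡ 0 →
       (μ 0 ≡ plus →
          deg plus (suc k) ≡ deg plus 0 + suc k * count plus
        × deg minus (suc k) ≡ deg minus 0 + suc k * count minus)
     × (μ 0 ≡ minus →
          deg plus (suc k) ≡ deg plus 0 + suc k * count minus
        × deg minus (suc k) ≡ deg minus 0 + suc k * count plus)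
  case-even-even k hp hq =
      (λ μ₀ → trans (deg-settled plus (fixed μ₀) plus μ₀ plus k) (+-assoc (deg plus 0) _ _)
            , trans (deg-settled plus (fixed μ₀) plus μ₀ minus k) (+-assoc (deg minus 0) _ _))
    , (λ μ₀ → trans (deg-settled minus (fixed μ₀) minus μ₀ plus k) (+-assoc (deg plus 0) _ _)
            , trans (deg-settled minus (fixed μ₀) minus μ₀ minus k) (+-assoc (deg minus 0) _ _))
    where
    fixed : ∀ {t} → μ 0 ≡ t → ∀ j → μ (suc j) ≡ t
    fixed μ₀ zero    = trans (μ-step 0) (trans (next-even-even hp hq (μ 0)) μ₀)
    fixed μ₀ (suc j) = trans (μ-step (suc j)) (trans (next-even-even hp hq (μ (suc j))) (fixed μ₀ j))

  case-odd-even : ∀ k → count plus % 2 ≡ 1 → count minus % 2 ≡ 0 →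
       (μ 0 ≡ plus →
          deg plus (suc k) ≡ deg plus 0 + suc k * count plus
        × deg minus (suc k) ≡ deg minus 0 + suc k * count minus)
     × (μ 0 ≡ minus →
          deg plus (suc k) ≡ deg plus 0 + count minus + k * count plus
        × deg minus (suc k) ≡ deg minus 0 + count plus + k * count minus)
  case-odd-even k hp hq =
      (λ μ₀ → trans (deg-settled plus settled plus μ₀ plus k) (+-assoc (deg plus 0) _ _)
            , trans (deg-settled plus settled plus μ₀ minus k) (+-assoc (deg minus 0) _ _))
    , (λ μ₀ → deg-settled plus settled minus μ₀ plus k
            , deg-settled plus settled minus μ₀ minus k)
    where
    settled : ∀ j → μ (suc j) ≡ plus
    settled j = trans (μ-step j) (next-odd-even hp hq (μ j))

-- The theorem: the four cases of `Iteration` for m = suc k.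
theorem5 : ∀ (n : ℕ) (G : Adj n) →
  1 < n →
  (∀ u v → G u v ≡ G v u) →
  (∀ v → G v v ≡ nothing) →
  ∀ (m : ℕ) (v : Fin n) → 1 ≤ m →
  let p = nPos G
      q = nNeg G
      d⁺ = posDeg (coronaPow G m) (embed m v)
      d⁻ = negDeg (coronaPow G m) (embed m v)
      d₀⁺ = posDeg G v
      d₀⁻ = negDeg G v
      μ = marking G v
  in
  -- (1) n₊, n₋ both odd
  (p % 2 ≡ 1 → q % 2 ≡ 1 →
     (m % 2 ≡ 0 →
        d⁺ ≡ d₀⁺ + (m / 2) * (p + q) × d⁻ ≡ d₀⁻ + (m / 2) * (p + q))
   × (m % 2 ≡ 1 → μ ≡ plus →
        d⁺ ≡ d₀⁺ + (suc m / 2) * p + ((m ∸ 1) / 2) * q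
      × d⁻ ≡ d₀⁻ + (suc m / 2) * q + ((m ∸ 1) / 2) * p)
   × (m % 2 ≡ 1 → μ ≡ minus →
        d⁺ ≡ d₀⁺ + (suc m / 2) * q + ((m ∸ 1) / 2) * p
      × d⁻ ≡ d₀⁻ + (suc m / 2) * p + ((m ∸ 1) / 2) * q))
  -- (2) n₊ even, n₋ odd
  × (p % 2 ≡ 0 → q % 2 ≡ 1 →
       (μ ≡ plus → d⁺ ≡ d₀⁺ + p + (m ∸ 1) * q × d⁻ ≡ d₀⁻ + q + (m ∸ 1) * p)
     × (μ ≡ minus → d⁺ ≡ d₀⁺ + m * q × d⁻ ≡ d₀⁻ + m * p))
  -- (3) n₊, n₋ both even
  × (p % 2 ≡ 0 → q % 2 ≡ 0 →
       (μ ≡ plus → d⁺ ≡ d₀⁺ + m * p × d⁻ ≡ d₀⁻ + m * q)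
     × (μ ≡ minus → d⁺ ≡ d₀⁺ + m * q × d⁻ ≡ d₀⁻ + m * p))
  -- (4) n₊ odd, n₋ even
  × (p % 2 ≡ 1 → q % 2 ≡ 0 →
       (μ ≡ plus → d⁺ ≡ d₀⁺ + m * p × d⁻ ≡ d₀⁻ + m * q)
     × (μ ≡ minus → d⁺ ≡ d₀⁺ + q + (m ∸ 1) * p × d⁻ ≡ d₀⁻ + p + (m ∸ 1) * q))
theorem5 n G _ _ _ (suc k) v _ =
    case-odd-odd (suc k) , case-even-odd k , case-even-even k , case-odd-even k
  where open Iteration G v
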